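{- Let $G$ be a finite simple graph with at least one vertex. If $G$ is connected and has no s-duo, then there exists a vertex $v \in V(G)$ such that $G - v$ is connected and $G - v$ has at most one s-duo.
   Context: A subset $M \subseteq V(G)$ is a module of the graph $G$ if for all $x,y \in M$ and all $w \in V(G)\setminus M$, $w$ is adjacent to $x$ iff $w$ is adjacent to $y$. An s-duo of $G$ is a module $\{a,b\}$ of $G$ with $a\neq b$ and $a,b$ non-adjacent. $G - v$ is the subgraph induced by $V(G)\setminus\{v\}$. -}

module Defs where

open import Data.Nat using (ℕ; suc)
open import Data.Fin using (Fin; punchIn)
open import Data.Product using (_×_)
open import Data.Sum using (_⊎_)
open import Relation.Nullary using (¬_; Dec)
open import Relation.Binary.PropositionalEquality using (_≡_; _≢_)
open import Level using (0ℓ)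

record Graph (n : ℕ) : Set₁ where
  field
    Adj    : Fin n → Fin n → Set
    adj?   : ∀ x y → Dec (Adj x y)
    sym    : ∀ {x y} → Adj x y → Adj y x
    irrefl : ∀ x → ¬ Adj x x
open Graph public

data Walk {n : ℕ} (G : Graph n) : Fin n → Fin n → Set where
  here  : ∀ {x} → Walk G x x
  step  : ∀ {x y z} → Adj G x y → Walk G y z → Walk G x z

Connected : ∀ {n} → Graph n → Set
Connected G = ∀ x y → Walk G x y

IsModule2 : ∀ {n} → Graph n → Fin n → Fin n → Set
IsModule2 G a b = ∀ w → w ≢ a → w ≢ b → (Adj G w a → Adj G w b) × (Adj G w b → Adj G w a)

IsSDuo : ∀ {n} → Graph n → Fin n → Fin n → Set
IsSDuo G a b = a ≢ b × ¬ Adj G a b × IsModule2 G a b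

HasNoSDuo : ∀ {n} → Graph n → Set
HasNoSDuo G = ∀ a b → ¬ IsSDuo G a b

AtMostOneSDuo : ∀ {n} → Graph n → Set
AtMostOneSDuo G = ∀ a b c d → IsSDuo G a b → IsSDuo G c d →
  (a ≡ c × b ≡ d) ⊎ (a ≡ d × b ≡ c)

-- G - v : the subgraph induced on all vertices other than v,
-- with vertices re-indexed by Fin n via punchIn v.
delete : ∀ {n} → Graph (suc n) → Fin (suc n) → Graph n
delete G v = record
  { Adj    = λ x y → Adj G (punchIn v x) (punchIn v y)
  ; adj?   = λ x y → adj? G (punchIn v x) (punchIn v y)
  ; sym    = sym G
  ; irrefl = λ x → irrefl G (punchIn v x)
  }

-- A connected graph on at least two vertices has a vertex v whose deletion
-- keeps it connected (grow a connected vertex set one neighbour at a time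
-- until a single vertex is left outside). If G - v has an s-duo {a, b}, the
-- absence of s-duos in G forces v to be adjacent to exactly one of them, say
-- a; then N(b) ⊆ N(a), so b is not a cut vertex either, and every s-duo of
-- G - b consists of v and a neighbour of b. Two such s-duos {x, v}, {x', v}
-- with x ≠ x' would make {x, x'} an s-duo of G - b that b does not split,
-- that is, an s-duo of G.
module Submission where

open import Defs
open import Data.Nat using (ℕ; zero; suc)
open import Data.Fin using (Fin; zero; suc; punchIn; _≟_)
open import Data.Fin.Properties using (punchIn-injective; punchInᵢ≢i; punchIn-punchOut; any?; all?)
open import Data.Fin.Subset using (Subset; _∈_; _∉_; _⊃_; _∪_; ⁅_⁆; ∁; Nonempty)
open import Data.Fin.Subset.Properties
  using (_∈?_; nonempty?; x∈⁅x⁆; x∈⁅y⁆⇒x≡y; x≢y⇒x∉⁅y⁆; x∉p⇒x∈∁p; x∈∁p⇒x∉p; x∉∁p⇒x∈p; p⊆p∪q; q⊆p∪q; x∈p∪q⁻)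
open import Data.Fin.Subset.Induction using (⊃-wellFounded)
open import Induction.WellFounded using (Acc; acc)
open import Data.Product using (Σ; ∃₂; _×_; _,_; proj₁; proj₂)
open import Data.Sum using (_⊎_; inj₁; inj₂)
open import Data.Empty using (⊥-elim)
open import Function using (_∘_)
open import Relation.Nullary using (¬_; Dec; yes; no; contradiction)
open import Relation.Nullary.Decidable using (¬?; _×-dec_; _→-dec_)
open import Relation.Binary.PropositionalEquality using (_≡_; _≢_; refl; trans; cong; subst) renaming (sym to ≡-sym)

data WalkWithin {n} (G : Graph n) (P : Fin n → Set) : Fin n → Fin n → Set where
  here : ∀ {x} → WalkWithin G P x x
  step : ∀ {x y z} → Adj G x y → P y → WalkWithin G P y z → WalkWithin G P x z

module _ {n} {G : Graph n} where

  WalkWithin-map : ∀ {P Q : Fin n → Set} → (∀ {z} → P z → Q z) →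
                   ∀ {x y} → WalkWithin G P x y → WalkWithin G Q x y
  WalkWithin-map f here         = here
  WalkWithin-map f (step e p w) = step e (f p) (WalkWithin-map f w)

  _++_ : ∀ {P x y z} → WalkWithin G P x y → WalkWithin G P y z → WalkWithin G P x z
  here       ++ w′ = w′
  step e p w   ++ w′ = step e p (w ++ w′)

NonCut : ∀ {n} → Graph n → Fin n → Set
NonCut G v = ∀ x y → x ≢ v → y ≢ v → WalkWithin G (_≢ v) x y

punchIn-onto-≢ : ∀ {n} {v z : Fin (suc n)} → z ≢ v → Σ (Fin n) λ x → punchIn v x ≡ z
punchIn-onto-≢ z≢v = _ , punchIn-punchOut (z≢v ∘ ≡-sym)

module _ {n} (G : Graph (suc n)) (v : Fin (suc n)) where

  WalkWithin⇒Walk-delete : ∀ {x y′} y → punchIn v y ≡ y′ →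
                           WalkWithin G (_≢ v) (punchIn v x) y′ → Walk (delete G v) x y
  WalkWithin⇒Walk-delete {x} y py here with punchIn-injective v y x py
  ... | refl = here
  WalkWithin⇒Walk-delete y py (step e z≢v w) with punchIn-onto-≢ z≢v
  ... | z , refl = step e (WalkWithin⇒Walk-delete y py w)

  NonCut⇒Connected-delete : NonCut G v → Connected (delete G v)
  NonCut⇒Connected-delete nc x y = WalkWithin⇒Walk-delete y refl
    (nc (punchIn v x) (punchIn v y) (punchInᵢ≢i v x) (punchInᵢ≢i v y))

module _ {n} (G : Graph n) {a b : Fin n} (a≢b : a ≢ b)
         (dominated : ∀ {z} → Adj G z b → Adj G z a) where

  -- Every visit of the walk to b is replaced by a visit to a.
  reroute : ∀ {x y} → y ≢ b → Walk G x y → WalkWithin G (_≢ b) x y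
  reroute y≢b here = here
  reroute y≢b (step {y = z} e w) with z ≟ b
  ... | no z≢b = step e z≢b (reroute y≢b w)
  reroute y≢b (step e here)                  | yes refl = ⊥-elim (y≢b refl)
  reroute y≢b (step e (step {y = z} e′ w)) | yes refl =
    step (dominated e) a≢b (step (sym G (dominated (sym G e′))) z≢b (reroute y≢b w))
    where
      z≢b : z ≢ b
      z≢b refl = irrefl G b e′

  dominated⇒NonCut : Connected G → NonCut G b
  dominated⇒NonCut conn x y _ y≢b = reroute y≢b (conn x y)

module _ {n} (G : Graph n) where

  SubsetConnected : Subset n → Set
  SubsetConnected S = ∀ {x y} → x ∈ S → y ∈ S → WalkWithin G (_∈ S) x y

  walk-leaves : ∀ S {x y} → Walk G x y → x ∈ S → y ∉ S →
                Σ (Fin n) λ s → Σ (Fin n) λ u → s ∈ S × u ∉ S × Adj G s u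
  walk-leaves S here x∈S x∉S = contradiction x∈S x∉S
  walk-leaves S {x} (step {y = z} e w) x∈S y∉S with z ∈? S
  ... | yes z∈S = walk-leaves S w z∈S y∉S
  ... | no z∉S  = x , z , x∈S , z∉S , e

  SubsetConnected-∪⁅⁆ : ∀ {S s u} → SubsetConnected S → s ∈ S → Adj G s u →
                        SubsetConnected (S ∪ ⁅ u ⁆)
  SubsetConnected-∪⁅⁆ {S} {s} {u} ic s∈S e {x} {y} x∈ y∈
    with x∈p∪q⁻ S ⁅ u ⁆ x∈ | x∈p∪q⁻ S ⁅ u ⁆ y∈
  ... | inj₁ x∈S | inj₁ y∈S = WalkWithin-map (p⊆p∪q ⁅ u ⁆) (ic x∈S y∈S)
  ... | inj₁ x∈S | inj₂ y∈u rewrite x∈⁅y⁆⇒x≡y u y∈u =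
    WalkWithin-map (p⊆p∪q ⁅ u ⁆) (ic x∈S s∈S) ++ step e (q⊆p∪q S ⁅ u ⁆ (x∈⁅x⁆ u)) here
  ... | inj₂ x∈u | inj₁ y∈S rewrite x∈⁅y⁆⇒x≡y u x∈u =
    step (sym G e) (p⊆p∪q ⁅ u ⁆ s∈S) (WalkWithin-map (p⊆p∪q ⁅ u ⁆) (ic s∈S y∈S))
  ... | inj₂ x∈u | inj₂ y∈u rewrite x∈⁅y⁆⇒x≡y u x∈u | x∈⁅y⁆⇒x≡y u y∈u = here

  -- Once S ∪ {u} is everything, u is a non-cut vertex.
  grow : Connected G → ∀ S → Acc _⊃_ S → SubsetConnected S → Nonempty S → Nonempty (∁ S) →
         Σ (Fin n) (NonCut G)
  grow conn S (acc larger) ic (s₀ , s₀∈S) (u₀ , u₀∈∁S)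
    with walk-leaves S (conn s₀ u₀) s₀∈S (x∈∁p⇒x∉p u₀∈∁S)
  ... | s , u , s∈S , u∉S , e with nonempty? (∁ (S ∪ ⁅ u ⁆))
  ... | yes rest = grow conn (S ∪ ⁅ u ⁆) (larger S∪u⊃S) (SubsetConnected-∪⁅⁆ ic s∈S e)
                        (s , p⊆p∪q ⁅ u ⁆ s∈S) rest
    where
      S∪u⊃S : (S ∪ ⁅ u ⁆) ⊃ S
      S∪u⊃S = p⊆p∪q ⁅ u ⁆ , u , q⊆p∪q S ⁅ u ⁆ (x∈⁅x⁆ u) , u∉S
  ... | no none = u , λ x y x≢u y≢u → WalkWithin-map (λ z∈S z≡u → u∉S (subst (_∈ S) z≡u z∈S))
                                                     (ic (∈S x x≢u) (∈S y y≢u))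
    where
      ∈S : ∀ x → x ≢ u → x ∈ S
      ∈S x x≢u with x∈p∪q⁻ S ⁅ u ⁆ (x∉∁p⇒x∈p (λ x∈∁ → none (x , x∈∁)))
      ... | inj₁ x∈S = x∈S
      ... | inj₂ x∈u = contradiction (x∈⁅y⁆⇒x≡y u x∈u) x≢u

nonCut-exists : ∀ {n} (G : Graph (suc (suc n))) → Connected G → Σ (Fin (suc (suc n))) (NonCut G)
nonCut-exists G conn = grow G conn ⁅ zero ⁆ (⊃-wellFounded _) singleton (zero , x∈⁅x⁆ zero)
  (suc zero , x∉p⇒x∈∁p (x≢y⇒x∉⁅y⁆ {y = zero} λ ()))
  where
    singleton : SubsetConnected G ⁅ zero ⁆
    singleton x∈ y∈ rewrite x∈⁅y⁆⇒x≡y zero x∈ | x∈⁅y⁆⇒x≡y zero y∈ = here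

Agrees : ∀ {n} → Graph n → Fin n → Fin n → Fin n → Set
Agrees G z x y = (Adj G z x → Adj G z y) × (Adj G z y → Adj G z x)

ModuleExcept : ∀ {n} → Graph n → Fin n → Fin n → Fin n → Set
ModuleExcept G v x y = ∀ z → z ≢ v → z ≢ x → z ≢ y → Agrees G z x y

module _ {n} (G : Graph n) where

  Agrees-sym : ∀ {z x y} → Agrees G z x y → Agrees G z y x
  Agrees-sym (to , from) = from , to

  Agrees-trans : ∀ {z x y w} → Agrees G z x w → Agrees G z w y → Agrees G z x y
  Agrees-trans (to , from) (to′ , from′) = to′ ∘ to , from ∘ from′

  ¬Agrees⇒splits : ∀ {z x y} → ¬ Agrees G z x y →
                   (Adj G z x × ¬ Adj G z y) ⊎ (Adj G z y × ¬ Adj G z x)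
  ¬Agrees⇒splits {z} {x} {y} ¬agree with adj? G z x | adj? G z y
  ... | yes zx | yes zy = contradiction ((λ _ → zy) , (λ _ → zx)) ¬agree
  ... | yes zx | no ¬zy = inj₁ (zx , ¬zy)
  ... | no ¬zx | yes zy = inj₂ (zy , ¬zx)
  ... | no ¬zx | no ¬zy =
    contradiction ((λ zx → contradiction zx ¬zx) , (λ zy → contradiction zy ¬zy)) ¬agree

  ModuleExcept⇒IsModule2 : ∀ {v x y} → ModuleExcept G v x y → Agrees G v x y → IsModule2 G x y
  ModuleExcept⇒IsModule2 {v} m agree z z≢x z≢y with z ≟ v
  ... | yes refl = agree
  ... | no z≢v   = m z z≢v z≢x z≢y

  ModuleExcept⇒Agrees : ∀ {v x y} → ¬ Adj G x y → ModuleExcept G v x y →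
                        ∀ z → z ≢ v → Agrees G z x y
  ModuleExcept⇒Agrees {x = x} {y} ¬xy m z z≢v with z ≟ x | z ≟ y
  ... | yes refl | _        = (λ zz → contradiction zz (irrefl G z)) , (λ zy → contradiction zy ¬xy)
  ... | no _     | yes refl = (λ xz → contradiction (sym G xz) ¬xy) , (λ zz → contradiction zz (irrefl G z))
  ... | no z≢x   | no z≢y   = m z z≢v z≢x z≢y

  IsSDuo-sym : ∀ {x y} → IsSDuo G x y → IsSDuo G y x
  IsSDuo-sym (x≢y , ¬xy , m) = x≢y ∘ ≡-sym , ¬xy ∘ sym G , λ z z≢y z≢x → Agrees-sym (m z z≢x z≢y)

  IsSDuo-trans : ∀ {x y w} → IsSDuo G x w → IsSDuo G w y → x ≢ y → IsSDuo G x y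
  IsSDuo-trans {x} {y} {w} (x≢w , ¬xw , mxw) (w≢y , ¬wy , mwy) x≢y = x≢y , ¬xy , mxy
    where
      ¬xy : ¬ Adj G x y
      ¬xy xy = ¬wy (sym G (proj₁ (mxw y (x≢y ∘ ≡-sym) (w≢y ∘ ≡-sym)) (sym G xy)))
      mxy : IsModule2 G x y
      mxy z z≢x z≢y with z ≟ w
      ... | yes refl = (λ wx → contradiction (sym G wx) ¬xw) , (λ wy → contradiction wy ¬wy)
      ... | no z≢w   = Agrees-trans (mxw z z≢x z≢w) (mwy z z≢w z≢y)

  Agrees? : ∀ z x y → Dec (Agrees G z x y)
  Agrees? z x y = (adj? G z x →-dec adj? G z y) ×-dec (adj? G z y →-dec adj? G z x)

  IsSDuo? : ∀ x y → Dec (IsSDuo G x y)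
  IsSDuo? x y = ¬? (x ≟ y) ×-dec ¬? (adj? G x y) ×-dec
    all? λ z → ¬? (z ≟ x) →-dec ¬? (z ≟ y) →-dec Agrees? z x y

  HasSDuo? : Dec (∃₂ (IsSDuo G))
  HasSDuo? = any? λ x → any? λ y → IsSDuo? x y

module _ {n} (G : Graph (suc n)) (v : Fin (suc n)) where

  IsModule2-delete⇒ModuleExcept : ∀ {p q} → IsModule2 (delete G v) p q →
                                  ModuleExcept G v (punchIn v p) (punchIn v q)
  IsModule2-delete⇒ModuleExcept m z z≢v z≢p z≢q with punchIn-onto-≢ z≢v
  ... | z′ , refl = m z′ (z≢p ∘ cong (punchIn v)) (z≢q ∘ cong (punchIn v))

  IsSDuo-delete⇒splits : HasNoSDuo G → ∀ {p q} → IsSDuo (delete G v) p q →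
                         ¬ Agrees G v (punchIn v p) (punchIn v q)
  IsSDuo-delete⇒splits noDuo {p} {q} (p≢q , ¬pq , m) agree = noDuo (punchIn v p) (punchIn v q)
    ( p≢q ∘ punchIn-injective v p q
    , ¬pq
    , ModuleExcept⇒IsModule2 G (IsModule2-delete⇒ModuleExcept m) agree )

record SplitOnlyBy {n} (G : Graph n) (w a b : Fin n) : Set where
  field
    adj-a    : Adj G w a
    nonadj-b : ¬ Adj G w b
    agrees   : ∀ z → z ≢ w → Agrees G z a b

IsSDuo-delete⇒SplitOnlyBy : ∀ {n} (G : Graph (suc n)) (v : Fin (suc n)) {p q} →
                            IsSDuo (delete G v) p q → Adj G v (punchIn v p) → ¬ Adj G v (punchIn v q) →
                            SplitOnlyBy G v (punchIn v p) (punchIn v q)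
IsSDuo-delete⇒SplitOnlyBy G v (_ , ¬pq , m) vp ¬vq = record
  { adj-a    = vp
  ; nonadj-b = ¬vq
  ; agrees   = ModuleExcept⇒Agrees G ¬pq (IsModule2-delete⇒ModuleExcept G v m)
  }

module _ {n} (G : Graph (suc n)) (noDuo : HasNoSDuo G) {w a b} (split : SplitOnlyBy G w a b) where
  open SplitOnlyBy split

  private
    P : Fin n → Fin (suc n)
    P = punchIn b

    flip : ∀ {p q} → IsSDuo (delete G b) p q → IsSDuo (delete G b) q p
    flip = IsSDuo-sym (delete G b)

    w≢a : w ≢ a
    w≢a refl = irrefl G w adj-a

    ¬ab : ¬ Adj G a b
    ¬ab ab = irrefl G a (proj₂ (agrees a (w≢a ∘ ≡-sym)) ab)

    a≢b : a ≢ b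
    a≢b refl = nonadj-b adj-a

    w≢b : w ≢ b
    w≢b refl = ¬ab (sym G adj-a)

  N[b]⊆N[a] : ∀ {z} → Adj G z b → Adj G z a
  N[b]⊆N[a] {z} zb with z ≟ w
  ... | yes refl = contradiction zb nonadj-b
  ... | no z≢w   = proj₂ (agrees z z≢w) zb

  -- If an s-duo {p, q} of G - b is split by b, then a lies outside it and
  -- is adjacent to p, hence to q; so q cannot agree with b on {a, b}.
  IsSDuo-delete-other-end : ∀ {p q} → IsSDuo (delete G b) p q →
                            Adj G b (P p) → ¬ Adj G b (P q) → P q ≡ w
  IsSDuo-delete-other-end {p} {q} (_ , ¬pq , m) bp ¬bq with P q ≟ w
  ... | yes Pq≡w = Pq≡w
  ... | no Pq≢w  = contradiction (sym G (proj₁ (agrees (P q) Pq≢w) (sym G aq))) ¬bq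
    where
      ap : Adj G a (P p)
      ap = sym G (N[b]⊆N[a] (sym G bp))
      a≢p : a ≢ P p
      a≢p refl = irrefl G a ap
      a≢q : a ≢ P q
      a≢q refl = ¬pq (sym G ap)
      aq : Adj G a (P q)
      aq = proj₁ (IsModule2-delete⇒ModuleExcept G b m a a≢b a≢p a≢q) ap

  private
    c : Fin n
    c = proj₁ (punchIn-onto-≢ w≢b)

    P≡w⇒≡c : ∀ {q} → P q ≡ w → q ≡ c
    P≡w⇒≡c {q} Pq≡w = punchIn-injective b q c (trans Pq≡w (≡-sym (proj₂ (punchIn-onto-≢ w≢b))))

  IsSDuo-delete-anchored : ∀ {p q} → IsSDuo (delete G b) p q →
                           (Adj G b (P p) × q ≡ c) ⊎ (Adj G b (P q) × p ≡ c)
  IsSDuo-delete-anchored d with ¬Agrees⇒splits G (IsSDuo-delete⇒splits G b noDuo d)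
  ... | inj₁ (bp , ¬bq) = inj₁ (bp , P≡w⇒≡c (IsSDuo-delete-other-end d bp ¬bq))
  ... | inj₂ (bq , ¬bp) = inj₂ (bq , P≡w⇒≡c (IsSDuo-delete-other-end (flip d) bq ¬bp))

  partner-unique : ∀ {x y} → IsSDuo (delete G b) x c → IsSDuo (delete G b) y c →
                   Adj G b (P x) → Adj G b (P y) → x ≡ y
  partner-unique {x} {y} dx dy bx by with x ≟ y
  ... | yes x≡y = x≡y
  ... | no x≢y  = contradiction ((λ _ → by) , (λ _ → bx)) (IsSDuo-delete⇒splits G b noDuo dxy)
    where
      dxy : IsSDuo (delete G b) x y
      dxy = IsSDuo-trans (delete G b) dx (flip dy) x≢y

  AtMostOneSDuo-delete : AtMostOneSDuo (delete G b)
  AtMostOneSDuo-delete p q r s d e with IsSDuo-delete-anchored d | IsSDuo-delete-anchored e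
  ... | inj₁ (bp , refl) | inj₁ (br , refl) = inj₁ (partner-unique d e bp br , refl)
  ... | inj₁ (bp , refl) | inj₂ (bs , refl) = inj₂ (partner-unique d (flip e) bp bs , refl)
  ... | inj₂ (bq , refl) | inj₁ (br , refl) = inj₂ (refl , partner-unique (flip d) e bq br)
  ... | inj₂ (bq , refl) | inj₂ (bs , refl) = inj₁ (refl , partner-unique (flip d) (flip e) bq bs)

  SplitOnlyBy⇒removable : Connected G → Connected (delete G b) × AtMostOneSDuo (delete G b)
  SplitOnlyBy⇒removable conn =
    NonCut⇒Connected-delete G b (dominated⇒NonCut G a≢b N[b]⊆N[a] conn) , AtMostOneSDuo-delete

lemma4 : (n : ℕ) (G : Graph (suc n)) → Connected G → HasNoSDuo G →
    Σ (Fin (suc n)) (λ v → Connected (delete G v) × AtMostOneSDuo (delete G v))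
lemma4 zero G _ _ = zero , (λ ()) , (λ ())
lemma4 (suc n) G conn noDuo with nonCut-exists G conn
... | v , v-nonCut with HasSDuo? (delete G v)
... | no none =
  v , NonCut⇒Connected-delete G v v-nonCut , λ p q _ _ d _ → contradiction (p , q , d) none
... | yes (p , q , d) with ¬Agrees⇒splits G (IsSDuo-delete⇒splits G v noDuo d)
... | inj₁ (vp , ¬vq) =
  _ , SplitOnlyBy⇒removable G noDuo (IsSDuo-delete⇒SplitOnlyBy G v d vp ¬vq) conn
... | inj₂ (vq , ¬vp) =
  _ , SplitOnlyBy⇒removable G noDuo (IsSDuo-delete⇒SplitOnlyBy G v (IsSDuo-sym (delete G v) d) vq ¬vp) conn
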